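{- Let $\mathcal T$ be a tower diagram and let $\alpha,\beta$ be positive integers with $|\beta-\alpha|\ge 2$. Then either both iterated slides $\alpha^{\searrow}(\beta^{\searrow}\mathcal T)$ and $\beta^{\searrow}(\alpha^{\searrow}\mathcal T)$ are defined and $\alpha^{\searrow}(\beta^{\searrow}\mathcal T)=\beta^{\searrow}(\alpha^{\searrow}\mathcal T)$, or both of them terminate.
   Context: A cell is a pair $(i,j)$ of integers with $i\ge 1$, $j\ge 0$. A tower diagram is a finite set $\mathcal T$ of cells such that $(i,j)\in\mathcal T$ and $0\le k\le j$ imply $(i,k)\in\mathcal T$. The cell $(i,j)$ lies on the diagonal $x+y=i+j$. Sliding: for a positive integer $\alpha$, the slide $\alpha^{\searrow}\mathcal T$ is either a tower diagram or terminates (without result); it is computed by the procedure $P(\gamma,m)$ started at $\gamma=\alpha$, $m=1$: (S1) if no cell $(i,j)\in\mathcal T$ with $i\ge m$ lies on the diagonal $x+y=\gamma-1$, then: (a) if $(\gamma,0)\notin\mathcal T$ the result is $\mathcal T\cup\{(\gamma,0)\}$; (b) if $(\gamma,0)\in\mathcal T$ and $(\gamma,1)\notin\mathcal T$ the slide terminates; (c) if $(\gamma,0),(\gamma,1)\in\mathcal T$, continue with $P(\gamma+1,\gamma+1)$. (S2) Otherwise let $i\ge m$ be the smallest index with $(i,\gamma-1-i)\in\mathcal T$; then: (a) if $(i,\gamma-i)\notin\mathcal T$ the result is $\mathcal T\cup\{(i,\gamma-i)\}$; (b) if $(i,\gamma-i)\in\mathcal T$ and $(i,\gamma-i+1)\notin\mathcal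 T$ the slide terminates; (c) if $(i,\gamma-i),(i,\gamma-i+1)\in\mathcal T$, continue with $P(\gamma+1,i+1)$. An iterated slide $\alpha^{\searrow}(\beta^{\searrow}\mathcal T)$ terminates if $\beta^{\searrow}\mathcal T$ terminates or if the slide of $\alpha$ into the resulting diagram terminates. -}

module Defs where

open import Data.Nat using (ℕ; zero; suc; _+_; _≤_; _<_)
open import Data.Product using (Σ; ∃; _×_; _,_)
open import Data.Sum using (_⊎_)
open import Data.Maybe using (Maybe; just; nothing)
open import Data.Unit using (⊤)
open import Data.Empty using (⊥)
open import Relation.Nullary using (¬_)
open import Relation.Binary.PropositionalEquality using (_≡_)
open import Function.Bundles using (_⇔_)

Cell : Set
Cell = ℕ × ℕ

-- A tower diagram: a finite set of cells closed downward in each column i.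
-- Such a set is determined by the heights of its towers: column i contains
-- exactly the cells (i , 0) , … , (i , height i - 1).  Column 0 is empty
-- (cells have i ≥ 1), and only finitely many columns are nonempty.
record TowerDiagram : Set where
  field
    height   : ℕ → ℕ
    height0  : height 0 ≡ 0
    finite   : ∃ λ N → ∀ i → N ≤ i → height i ≡ 0

open TowerDiagram public

_∈T_ : Cell → TowerDiagram → Set
(i , j) ∈T T = 1 ≤ i × j < height T i

_≅T_ : TowerDiagram → TowerDiagram → Set
T ≅T T' = ∀ c → (c ∈T T) ⇔ (c ∈T T')

IsInsert : TowerDiagram → Cell → TowerDiagram → Set
IsInsert T c T' = ∀ d → (d ∈T T') ⇔ ((d ∈T T) ⊎ d ≡ c)

NoDiag : TowerDiagram → ℕ → ℕ → Set
NoDiag T γ m = ∀ i j → m ≤ i → i + j + 1 ≡ γ → ¬ ((i , j) ∈T T)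

MinDiag : TowerDiagram → ℕ → ℕ → ℕ → ℕ → Set
MinDiag T γ m i j =
  m ≤ i × i + j + 1 ≡ γ × (i , j) ∈T T ×
  (∀ k l → m ≤ k → k < i → k + l + 1 ≡ γ → ¬ ((k , l) ∈T T))

-- The procedure P(γ , m) applied to T, as an inductive relation with its
-- outcome: 'just T'' = result T', 'nothing' = the slide terminates.
data P (T : TowerDiagram) : ℕ → ℕ → Maybe TowerDiagram → Set where
  s1a : ∀ {γ m T'} → NoDiag T γ m → ¬ ((γ , 0) ∈T T) →
        IsInsert T (γ , 0) T' → P T γ m (just T')
  s1b : ∀ {γ m} → NoDiag T γ m → (γ , 0) ∈T T → ¬ ((γ , 1) ∈T T) →
        P T γ m nothing
  s1c : ∀ {γ m o} → NoDiag T γ m → (γ , 0) ∈T T → (γ , 1) ∈T T →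
        P T (suc γ) (suc γ) o → P T γ m o
  -- here j = γ - 1 - i, so (i , γ - i) = (i , suc j), (i , γ - i + 1) = (i , suc (suc j))
  s2a : ∀ {γ m i j T'} → MinDiag T γ m i j → ¬ ((i , suc j) ∈T T) →
        IsInsert T (i , suc j) T' → P T γ m (just T')
  s2b : ∀ {γ m i j} → MinDiag T γ m i j → (i , suc j) ∈T T →
        ¬ ((i , suc (suc j)) ∈T T) → P T γ m nothing
  s2c : ∀ {γ m i j o} → MinDiag T γ m i j → (i , suc j) ∈T T →
        (i , suc (suc j)) ∈T T → P T (suc γ) (suc i) o → P T γ m o

Slide : ℕ → TowerDiagram → Maybe TowerDiagram → Set
Slide α T o = P T α 1 o

data IterSlide (α β : ℕ) (T : TowerDiagram) : Maybe TowerDiagram → Set where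
  term-inner : Slide β T nothing → IterSlide α β T nothing
  step       : ∀ {T₁ o} → Slide β T (just T₁) → Slide α T₁ o → IterSlide α β T o

SameOutcome : Maybe TowerDiagram → Maybe TowerDiagram → Set
SameOutcome (just A) (just B) = A ≅T B
SameOutcome nothing  nothing  = ⊤
SameOutcome _        _        = ⊥

-- Write reach T i = i + height T i for the diagonal of the lowest empty cell
-- of column i.  P(γ, m) only looks at reaches: it takes the least column
-- i ≥ m with γ ≤ reach T i and adds a cell there, terminates, or climbs to
-- P(γ + 1, i + 1), according as reach T i is γ, γ + 1 or larger.  So a slide
-- is a walk through pairs (level, column), both increasing, and adding a cell
-- to column c raises reach T c, and nothing else, by one.  Such a change
-- cannot affect a step at level γ unless the step inspects column c and
-- |reach T c - γ| ≤ 1.  Let the β-walk put its cell into column c, at level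
-- reach T c.  If α + 2 ≤ β, then from level β - 1 on the α-walk starts strictly
-- right of where the β-walk one level higher chooses, so it is right of c
-- before it gets near reach T c.  If β + 2 ≤ α, the α-walk chooses weakly left
-- of the β-walk one level lower, hence strictly left of c, until the β-walk
-- has put its cell; after that α is two levels above reach T c.  Hence each
-- walk is the same in the diagram grown by the other, and the two added cells
-- commute.
module Submission where

open import Defs
open import Data.Nat using (ℕ; _+_; _≤_)
open import Data.Product using (Σ; ∃; _×_; _,_)
open import Data.Sum using (_⊎_)
open import Data.Maybe using (Maybe)

open import Data.Bool using (if_then_else_)
open import Data.Nat using (zero; suc; _∸_; _<_; _≟_; _≤?_; s≤s; z≤n)
open import Data.Nat.Properties
open import Algebra.Properties.CommutativeSemigroup +-commutativeSemigroup using (x∙yz≈y∙xz)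
open import Data.Product using (proj₁; proj₂)
open import Data.Sum using (inj₁; inj₂; swap)
open import Data.Maybe using (just; nothing)
open import Data.Unit using (tt)
open import Relation.Nullary using (¬_; does; yes; no; contradiction)
open import Relation.Nullary.Decidable using (dec-true; dec-false)
open import Relation.Binary.PropositionalEquality
open import Function.Bundles using (mk⇔)

≤⇒≡∨≡1+∨2+≤ : ∀ {m n} → m ≤ n → n ≡ m ⊎ n ≡ suc m ⊎ 2 + m ≤ n
≤⇒≡∨≡1+∨2+≤ m≤n with m≤n⇒m<n∨m≡n m≤n
... | inj₂ refl = inj₁ refl
... | inj₁ m<n with m≤n⇒m<n∨m≡n m<n
...   | inj₂ refl = inj₂ (inj₁ refl)
...   | inj₁ 1+m<n = inj₂ (inj₂ 1+m<n)

-- Column 0 is never grown, so that `height0` survives.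
δ : ℕ → ℕ → ℕ
δ c zero    = 0
δ c (suc i) = if does (suc i ≟ c) then 1 else 0

δ-≡ : ∀ {c} → 1 ≤ c → δ c c ≡ 1
δ-≡ {suc c} _ = cong (λ b → if b then 1 else 0) (dec-true (suc c ≟ suc c) refl)

δ-≢ : ∀ {c i} → ¬ i ≡ c → δ c i ≡ 0
δ-≢ {i = zero}  _   = refl
δ-≢ {i = suc i} i≢c = cong (λ b → if b then 1 else 0) (dec-false (suc i ≟ _) i≢c)

grow : TowerDiagram → ℕ → TowerDiagram
grow T c = record
  { height  = λ i → δ c i + height T i
  ; height0 = height0 T
  ; finite  = suc c + N , λ i c+N≤i →
      cong₂ _+_ (δ-≢ (>⇒≢ (≤-trans (m≤m+n (suc c) N) c+N≤i)))
                (proj₂ (finite T) i (≤-trans (m≤n+m N (suc c)) c+N≤i))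
  }
  where
  N : ℕ
  N = proj₁ (finite T)

module _ (T : TowerDiagram) {c : ℕ} where

  grow-height-≡ : 1 ≤ c → height (grow T c) c ≡ suc (height T c)
  grow-height-≡ 1≤c = cong (_+ height T c) (δ-≡ 1≤c)

  grow-height-≢ : ∀ {i} → ¬ i ≡ c → height (grow T c) i ≡ height T i
  grow-height-≢ i≢c = cong (_+ height T _) (δ-≢ i≢c)

  grow-insert : 1 ≤ c → IsInsert T (c , height T c) (grow T c)
  grow-insert 1≤c (i , j) with i ≟ c
  ... | yes refl rewrite grow-height-≡ 1≤c = mk⇔ to from
    where
    to : 1 ≤ c × j < suc (height T c) → (1 ≤ c × j < height T c) ⊎ (c , j) ≡ (c , height T c)
    to (_ , j<1+h) with m≤n⇒m<n∨m≡n (≤-pred j<1+h)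
    ... | inj₁ j<h  = inj₁ (1≤c , j<h)
    ... | inj₂ refl = inj₂ refl
    from : (1 ≤ c × j < height T c) ⊎ (c , j) ≡ (c , height T c) → 1 ≤ c × j < suc (height T c)
    from (inj₁ (_ , j<h)) = 1≤c , m<n⇒m<1+n j<h
    from (inj₂ refl)      = 1≤c , ≤-refl
  ... | no i≢c rewrite grow-height-≢ i≢c = mk⇔ inj₁ from
    where
    from : (1 ≤ i × j < height T i) ⊎ (i , j) ≡ (c , height T c) → 1 ≤ i × j < height T i
    from (inj₁ ij∈T) = ij∈T
    from (inj₂ refl) = contradiction refl i≢c

grow-comm : ∀ T c d i → height (grow (grow T c) d) i ≡ height (grow (grow T d) c) i
grow-comm T c d i = x∙yz≈y∙xz (δ d i) (δ c i) (height T i)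

height⇒≅T : ∀ A B → (∀ i → height A i ≡ height B i) → A ≅T B
height⇒≅T _ _ A≡B (i , j) = mk⇔ (λ (1≤i , j<h) → 1≤i , subst (j <_) (A≡B i) j<h)
                            (λ (1≤i , j<h) → 1≤i , subst (j <_) (sym (A≡B i)) j<h)

reach : TowerDiagram → ℕ → ℕ
reach T i = i + height T i

module _ (T : TowerDiagram) where

  reach-positive⇒column-positive : ∀ {i} → 1 ≤ reach T i → 1 ≤ i
  reach-positive⇒column-positive {zero}  1≤r = contradiction (subst (1 ≤_) (height0 T) 1≤r) λ ()
  reach-positive⇒column-positive {suc i} _   = s≤s z≤n

  reach-beyond-bound : ∀ {i} → proj₁ (finite T) ≤ i → reach T i ≡ i
  reach-beyond-bound {i} N≤i = trans (cong (i +_) (proj₂ (finite T) i N≤i)) (+-identityʳ i)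

  cell-∈ : ∀ {i k} → 1 ≤ i → i + k < reach T i → (i , k) ∈T T
  cell-∈ {i} {k} 1≤i i+k<r = 1≤i , +-cancelˡ-< i k (height T i) i+k<r

  cell-∉ : ∀ {i k} → reach T i ≤ i + k → ¬ (i , k) ∈T T
  cell-∉ {i} r≤i+k (_ , k<h) = <⇒≱ (+-monoʳ-< i k<h) r≤i+k

  off-diagonal : ∀ {k l γ} → reach T k < γ → k + l + 1 ≡ γ → ¬ (k , l) ∈T T
  off-diagonal {k} {l} r<γ kl1≡γ =
    cell-∉ (≤-pred (subst (reach T k <_) (trans (sym kl1≡γ) (+-comm (k + l) 1)) r<γ))

  reach-grow-≥ : ∀ c i → reach T i ≤ reach (grow T c) i
  reach-grow-≥ c i = +-monoʳ-≤ i (m≤n+m (height T i) (δ c i))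

  module _ {c : ℕ} where

    reach-grow-≡ : 1 ≤ c → reach (grow T c) c ≡ suc (reach T c)
    reach-grow-≡ 1≤c = trans (cong (c +_) (grow-height-≡ T 1≤c)) (+-suc c (height T c))

    reach-grow-≢ : ∀ {i} → ¬ i ≡ c → reach (grow T c) i ≡ reach T i
    reach-grow-≢ {i} i≢c = cong (i +_) (grow-height-≢ T i≢c)

record FirstReaching (T : TowerDiagram) (γ m i : ℕ) : Set where
  field
    start≤  : m ≤ i
    reaches : γ ≤ reach T i
    before  : ∀ k → m ≤ k → k < i → reach T k < γ

open FirstReaching public

module _ {T : TowerDiagram} {γ : ℕ} where

  first-reaching-≤ : ∀ {m i j} → FirstReaching T γ m i → m ≤ j → γ ≤ reach T j → i ≤ j
  first-reaching-≤ {i = i} {j} f m≤j γ≤r with i ≤? j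
  ... | yes i≤j = i≤j
  ... | no  i≰j = contradiction γ≤r (<⇒≱ (before f j m≤j (≰⇒> i≰j)))

  first-reaching-≤γ : ∀ {m i} → FirstReaching T γ m i → m ≤ γ → i ≤ γ
  first-reaching-≤γ f m≤γ = first-reaching-≤ f m≤γ (m≤m+n γ _)

  first-reaching-here : ∀ {m} → γ ≤ reach T m → FirstReaching T γ m m
  first-reaching-here γ≤r = record
    { start≤ = ≤-refl ; reaches = γ≤r ; before = λ k m≤k k<m → contradiction k<m (≤⇒≯ m≤k) }

  first-reaching-skip : ∀ {m i} → reach T m < γ → FirstReaching T γ (suc m) i → FirstReaching T γ m i
  first-reaching-skip {m} r<γ f = record
    { start≤ = ≤-trans (n≤1+n m) (start≤ f) ; reaches = reaches f ; before = before′ }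
    where
    before′ : ∀ k → m ≤ k → k < _ → reach T k < γ
    before′ k m≤k k<i with m≤n⇒m<n∨m≡n m≤k
    ... | inj₁ m<k  = before f k m<k k<i
    ... | inj₂ refl = r<γ

  first-reaching : ∀ d m → m + d ≡ γ → Σ ℕ (FirstReaching T γ m)
  first-reaching zero m m+0≡γ =
    m , first-reaching-here (subst (_≤ reach T m) m+0≡γ (+-monoʳ-≤ m z≤n))
  first-reaching (suc d) m m+d≡γ with γ ≤? reach T m
  ... | yes γ≤r = m , first-reaching-here γ≤r
  ... | no  γ≰r = Data.Product.map₂ (first-reaching-skip (≰⇒> γ≰r))
                    (first-reaching d (suc m) (trans (sym (+-suc m d)) m+d≡γ))

-- The result `just i` means the new cell goes on top of column i.
data Walk (T : TowerDiagram) : ℕ → ℕ → Maybe ℕ → Set where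
  put   : ∀ {γ m i} → FirstReaching T γ m i → reach T i ≡ γ → Walk T γ m (just i)
  stuck : ∀ {γ m i} → FirstReaching T γ m i → reach T i ≡ suc γ → Walk T γ m nothing
  climb : ∀ {γ m i o} → FirstReaching T γ m i → 2 + γ ≤ reach T i →
          Walk T (suc γ) (suc i) o → Walk T γ m o

walk-from : ∀ T n {γ m} → proj₁ (finite T) ≤ n + m → m ≤ γ → Σ (Maybe ℕ) (Walk T γ m)
walk-from T n {γ} {m} N≤n+m m≤γ with first-reaching {T} (γ ∸ m) m (m+[n∸m]≡n m≤γ)
... | i , f with ≤⇒≡∨≡1+∨2+≤ (reaches f)
...   | inj₁ r≡γ        = just i , put f r≡γ
...   | inj₂ (inj₁ r≡1+γ) = nothing , stuck f r≡1+γ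
...   | inj₂ (inj₂ 2+γ≤r) = Data.Product.map₂ (climb f 2+γ≤r) (walk-on n N≤n+m)
  where
  i≤γ : i ≤ γ
  i≤γ = first-reaching-≤γ f m≤γ
  walk-on : ∀ n → proj₁ (finite T) ≤ n + m → Σ (Maybe ℕ) (Walk T (suc γ) (suc i))
  walk-on zero    N≤m     = contradiction
    (≤-trans 2+γ≤r (≤-reflexive (reach-beyond-bound T (≤-trans N≤m (start≤ f)))))
    (<⇒≱ (s≤s (m≤n⇒m≤1+n i≤γ)))
  walk-on (suc n) N≤1+n+m = walk-from T n
    (≤-trans N≤1+n+m (≤-trans (≤-reflexive (sym (+-suc n m))) (+-monoʳ-≤ n (s≤s (start≤ f)))))
    (s≤s i≤γ)

walk : ∀ T {γ} → 1 ≤ γ → Σ (Maybe ℕ) (Walk T γ 1)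
walk T 1≤γ = walk-from T (proj₁ (finite T)) (m≤m+n _ 1) 1≤γ

module _ {T : TowerDiagram} {c : ℕ} where

  target-reach : ∀ {γ m} → Walk T γ m (just c) → γ ≤ reach T c
  target-reach (put _ r≡γ)   = ≤-reflexive (sym r≡γ)
  target-reach (climb _ _ w) = ≤-trans (n≤1+n _) (target-reach w)

  start≤target : ∀ {γ m} → Walk T γ m (just c) → m ≤ c
  start≤target (put f _)     = start≤ f
  start≤target (climb f _ w) = ≤-trans (≤-trans (start≤ f) (n≤1+n _)) (start≤target w)

  walk-climbs-below-target : ∀ {γ m δ} → Walk T γ m (just c) → γ ≤ δ → δ < reach T c →
    ∃ λ b → m ≤ b × 2 + δ ≤ reach T b × Walk T (suc δ) (suc b) (just c)
  walk-climbs-below-target (put _ r≡γ) γ≤δ δ<r =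
    contradiction (≤-trans δ<r (≤-reflexive r≡γ)) (≤⇒≯ γ≤δ)
  walk-climbs-below-target (climb {i = i} f 2+γ≤r w) γ≤δ δ<r with m≤n⇒m<n∨m≡n γ≤δ
  ... | inj₂ refl = i , start≤ f , 2+γ≤r , w
  ... | inj₁ γ<δ with walk-climbs-below-target w γ<δ δ<r
  ...   | b , 1+i≤b , rest = b , ≤-trans (≤-trans (start≤ f) (n≤1+n i)) 1+i≤b , rest

-- The cell that P(γ, m) inspects: (γ , 0) in case (S1), (i , γ - i) in case (S2).
data Probe (T : TowerDiagram) (γ m : ℕ) : ℕ → ℕ → Set where
  axis     : NoDiag T γ m → Probe T γ m γ 0
  diagonal : ∀ {i j} → MinDiag T γ m i j → Probe T γ m i (suc j)

module _ {T : TowerDiagram} {γ m : ℕ} where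

  probe-put : ∀ {i k T′} → Probe T γ m i k → ¬ (i , k) ∈T T → IsInsert T (i , k) T′ →
              P T γ m (just T′)
  probe-put (axis no-diag)     = s1a no-diag
  probe-put (diagonal min-diag) = s2a min-diag

  probe-stuck : ∀ {i k} → Probe T γ m i k → (i , k) ∈T T → ¬ (i , suc k) ∈T T → P T γ m nothing
  probe-stuck (axis no-diag)      = s1b no-diag
  probe-stuck (diagonal min-diag) = s2b min-diag

  probe-climb : ∀ {i k o} → Probe T γ m i k → (i , k) ∈T T → (i , suc k) ∈T T →
                P T (suc γ) (suc i) o → P T γ m o
  probe-climb (axis no-diag)      = s1c no-diag
  probe-climb (diagonal min-diag) = s2c min-diag

  probe : ∀ {i} → FirstReaching T γ m i → 1 ≤ m → m ≤ γ → ∃ λ k → i + k ≡ γ × Probe T γ m i k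
  probe {i} f 1≤m m≤γ with m≤n⇒m<n∨m≡n (first-reaching-≤γ f m≤γ)
  ... | inj₂ refl = 0 , +-identityʳ i , axis no-diag
    where
    no-diag : NoDiag T γ m
    no-diag k l m≤k kl1≡γ = off-diagonal T (before f k m≤k (<-≤-trans (s≤s (m≤m+n k l))
                              (≤-reflexive (trans (+-comm 1 (k + l)) kl1≡γ)))) kl1≡γ
  ... | inj₁ i<γ with m≤n⇒∃[o]m+o≡n i<γ
  ...   | j , 1+i+j≡γ = suc j , trans (+-suc i j) 1+i+j≡γ , diagonal min-diag
    where
    ij1≡γ : i + j + 1 ≡ γ
    ij1≡γ = trans (+-comm (i + j) 1) 1+i+j≡γ
    min-diag : MinDiag T γ m i j
    min-diag = start≤ f , ij1≡γ ,
      cell-∈ T (≤-trans 1≤m (start≤ f)) (≤-trans (≤-reflexive 1+i+j≡γ) (reaches f)) ,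
      λ k l m≤k k<i → off-diagonal T (before f k m≤k k<i)

walk⇒P : ∀ {T γ m o} → Walk T γ m o → 1 ≤ m → m ≤ γ → P T γ m (Data.Maybe.map (grow T) o)
walk⇒P {T} (put {i = i} f r≡γ) 1≤m m≤γ with probe f 1≤m m≤γ
... | k , refl , p = probe-put p (cell-∉ T (≤-reflexive r≡γ))
  (subst (λ h → IsInsert T (i , h) (grow T i)) (+-cancelˡ-≡ i _ _ r≡γ)
         (grow-insert T (≤-trans 1≤m (start≤ f))))
walk⇒P {T} (stuck {i = i} f r≡1+γ) 1≤m m≤γ with probe f 1≤m m≤γ
... | k , refl , p = probe-stuck p (cell-∈ T (≤-trans 1≤m (start≤ f)) (≤-reflexive (sym r≡1+γ)))
  (cell-∉ T (≤-reflexive (trans r≡1+γ (sym (+-suc i k)))))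
walk⇒P {T} (climb {i = i} f 2+γ≤r w) 1≤m m≤γ with probe f 1≤m m≤γ
... | k , refl , p = probe-climb p (cell-∈ T 1≤i (≤-trans (n≤1+n _) 2+γ≤r))
  (cell-∈ T 1≤i (subst (_< reach T i) (sym (+-suc i k)) 2+γ≤r))
  (walk⇒P w (s≤s z≤n) (s≤s (first-reaching-≤γ f m≤γ)))
  where
  1≤i : 1 ≤ i
  1≤i = ≤-trans 1≤m (start≤ f)

walk⇒slide : ∀ {T γ o} → 1 ≤ γ → Walk T γ 1 o → Slide γ T (Data.Maybe.map (grow T) o)
walk⇒slide 1≤γ w = walk⇒P w ≤-refl 1≤γ

module Growth (T : TowerDiagram) (c : ℕ) (1≤c : 1 ≤ c) where

  T⁺ : TowerDiagram
  T⁺ = grow T c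

  data Unaffected (γ m i : ℕ) : Set where
    left-of-start   : c < m → Unaffected γ m i
    right-of-choice : i < c → Unaffected γ m i
    short           : 2 + reach T c ≤ γ → Unaffected γ m i
    tall            : 2 + γ ≤ reach T c → Unaffected γ m i

  module _ {γ m i : ℕ} where

    unaffected-≢ : Unaffected γ m i → FirstReaching T γ m i → reach T i ≤ suc γ → ¬ i ≡ c
    unaffected-≢ (left-of-start c<m)   f _     refl = <⇒≱ c<m (start≤ f)
    unaffected-≢ (right-of-choice c<c) _ _     refl = <-irrefl refl c<c
    unaffected-≢ (short 2+r≤γ)         f _     refl =
      1+n≰n (≤-trans (n≤1+n _) (≤-trans 2+r≤γ (reaches f)))
    unaffected-≢ (tall 2+γ≤r)          _ r≤1+γ refl = 1+n≰n (≤-trans 2+γ≤r r≤1+γ)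

    grown-before : Unaffected γ m i → m ≤ c → c < i → reach T c < γ → reach T⁺ c < γ
    grown-before (left-of-start c<m)   m≤c _   _    = contradiction m≤c (<⇒≱ c<m)
    grown-before (right-of-choice i<c) _   c<i _    = contradiction i<c (<⇒≯ c<i)
    grown-before (short 2+r≤γ)         _   _   _    = subst (_< γ) (sym (reach-grow-≡ T 1≤c)) 2+r≤γ
    grown-before (tall 2+γ≤r)          _   _   r<γ  =
      contradiction (≤-trans (m≤n+m γ 2) 2+γ≤r) (<⇒≱ r<γ)

    first-reaching-grow : Unaffected γ m i → FirstReaching T γ m i → FirstReaching T⁺ γ m i
    first-reaching-grow u f = record
      { start≤ = start≤ f ; reaches = ≤-trans (reaches f) (reach-grow-≥ T c i) ; before = before⁺ }
      where
      before⁺ : ∀ k → m ≤ k → k < i → reach T⁺ k < γ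
      before⁺ k m≤k k<i with k ≟ c
      ... | no  k≢c = subst (_< γ) (sym (reach-grow-≢ T k≢c)) (before f k m≤k k<i)
      ... | yes refl = grown-before u m≤k k<i (before f k m≤k k<i)

  walk-grow : (Inv : ℕ → ℕ → Set) →
    (∀ {γ m i} → Inv γ m → FirstReaching T γ m i → Unaffected γ m i) →
    (∀ {γ m i} → Inv γ m → FirstReaching T γ m i → 2 + γ ≤ reach T i → Inv (suc γ) (suc i)) →
    ∀ {γ m o} → Inv γ m → Walk T γ m o → Walk T⁺ γ m o
  walk-grow Inv unaffected climbs {γ} {m} inv (put {i = i} f r≡γ) =
    put (first-reaching-grow u f) (trans (reach-grow-≢ T (unaffected-≢ u f r≤1+γ)) r≡γ)
    where
    u : Unaffected γ m i
    u = unaffected inv f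
    r≤1+γ : reach T i ≤ suc γ
    r≤1+γ = ≤-trans (≤-reflexive r≡γ) (n≤1+n γ)
  walk-grow Inv unaffected climbs {γ} {m} inv (stuck {i = i} f r≡1+γ) =
    stuck (first-reaching-grow u f) (trans (reach-grow-≢ T (unaffected-≢ u f (≤-reflexive r≡1+γ))) r≡1+γ)
    where
    u : Unaffected γ m i
    u = unaffected inv f
  walk-grow Inv unaffected climbs inv (climb {i = i} f 2+γ≤r w) =
    climb (first-reaching-grow (unaffected inv f) f) (≤-trans 2+γ≤r (reach-grow-≥ T c i))
          (walk-grow Inv unaffected climbs (climbs inv f 2+γ≤r) w)

  -- Invariant of the α-walk at (γ, m) when α + 2 ≤ β: once the β-walk is one level up,
  -- it chooses left of m.
  data Below : ℕ → ℕ → Set where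
    well-below : ∀ {β γ m} → 2 + γ ≤ β → Walk T β 1 (just c) → Below γ m
    just-below : ∀ {γ m mb j} → Walk T (suc γ) mb (just c) → mb ≤ j → j < m → suc γ ≤ reach T j →
                 Below γ m
    passed     : ∀ {γ m} → c < m → Below γ m

  below-unaffected : ∀ {γ m i} → Below γ m → FirstReaching T γ m i → Unaffected γ m i
  below-unaffected (well-below 2+γ≤β wβ) _ = tall (≤-trans 2+γ≤β (target-reach wβ))
  below-unaffected (just-below (put f _) mb≤j j<m r) _ =
    left-of-start (≤-<-trans (first-reaching-≤ f mb≤j r) j<m)
  below-unaffected (just-below (climb _ _ w) _ _ _) _ = tall (target-reach w)
  below-unaffected (passed c<m) _ = left-of-start c<m

  below-climbs : ∀ {γ m i} → Below γ m → FirstReaching T γ m i → 2 + γ ≤ reach T i →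
                 Below (suc γ) (suc i)
  below-climbs (well-below 2+γ≤β wβ) f 2+γ≤r with m≤n⇒m<n∨m≡n 2+γ≤β
  ... | inj₁ 3+γ≤β = well-below 3+γ≤β wβ
  ... | inj₂ refl  = just-below wβ (reach-positive⇒column-positive T (≤-trans (s≤s z≤n) 2+γ≤r))
                       ≤-refl 2+γ≤r
  below-climbs (just-below (put f _) mb≤j j<m r) fα _ =
    passed (s≤s (≤-trans (first-reaching-≤ f mb≤j r) (≤-trans (<⇒≤ j<m) (start≤ fα))))
  below-climbs (just-below (climb f _ w) mb≤j j<m r) fα 2+γ≤r =
    just-below w (≤-<-trans (first-reaching-≤ f mb≤j r) (<-≤-trans j<m (start≤ fα))) ≤-refl 2+γ≤r
  below-climbs (passed c<m) fα _ = passed (≤-trans c<m (≤-trans (start≤ fα) (n≤1+n _)))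

  -- Invariant of the α-walk at (γ, m) when β + 2 ≤ α: until the β-walk has put its cell,
  -- the α-walk will choose at most b while the β-walk one level down starts at b + 1.
  data Above : ℕ → ℕ → Set where
    just-above : ∀ {γ m b} → m ≤ b → suc γ ≤ reach T b → Walk T γ (suc b) (just c) →
                 Above (suc γ) m
    well-above : ∀ {γ m} → 2 + reach T c ≤ γ → Above γ m

  above-unaffected : ∀ {γ m i} → Above γ m → FirstReaching T γ m i → Unaffected γ m i
  above-unaffected (just-above m≤b r wβ) f =
    right-of-choice (≤-<-trans (first-reaching-≤ f m≤b r) (start≤target wβ))
  above-unaffected (well-above 2+r≤γ) _ = short 2+r≤γ

  above-climbs : ∀ {γ m i} → Above γ m → FirstReaching T γ m i → 2 + γ ≤ reach T i →
                 Above (suc γ) (suc i)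
  above-climbs (just-above _ _ (put _ r≡γ)) _ _ = well-above (≤-reflexive (cong (2 +_) r≡γ))
  above-climbs (just-above m≤b r (climb f 2+γ≤r′ w)) fα _ =
    just-above (≤-<-trans (first-reaching-≤ fα m≤b r) (start≤ f)) 2+γ≤r′ w
  above-climbs (well-above 2+r≤γ) _ _ = well-above (≤-trans 2+r≤γ (n≤1+n _))

  above-start : ∀ {α β} → Walk T β 1 (just c) → 2 + β ≤ α → Above α 1
  above-start {α} wβ 2+β≤α with 2 + reach T c ≤? α
  above-start wβ 2+β≤α             | yes 2+r≤α = well-above 2+r≤α
  above-start wβ (s≤s (s≤s β≤δ)) | no  2+r≰α
    with b , 1≤b , 2+δ≤r , w ← walk-climbs-below-target wβ β≤δ (≤-pred (≤-pred (≰⇒> 2+r≰α)))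
    = just-above 1≤b 2+δ≤r w

  walk-grow-apart : ∀ {α β o} → Walk T β 1 (just c) → Walk T α 1 o → 2 + α ≤ β ⊎ 2 + β ≤ α →
                    Walk T⁺ α 1 o
  walk-grow-apart wβ wα (inj₁ 2+α≤β) =
    walk-grow Below below-unaffected below-climbs (well-below 2+α≤β wβ) wα
  walk-grow-apart wβ wα (inj₂ 2+β≤α) =
    walk-grow Above above-unaffected above-climbs (above-start wβ 2+β≤α) wα

grow₂ : TowerDiagram → Maybe ℕ → Maybe ℕ → Maybe TowerDiagram
grow₂ T (just c) o = Data.Maybe.map (grow (grow T c)) o
grow₂ T nothing  _ = nothing

grow₂-comm : ∀ T o o′ → SameOutcome (grow₂ T o o′) (grow₂ T o′ o)
grow₂-comm T (just c) (just d) = height⇒≅T (grow (grow T c) d) (grow (grow T d) c) (grow-comm T c d)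
grow₂-comm T (just c) nothing  = tt
grow₂-comm T nothing  (just d) = tt
grow₂-comm T nothing  nothing  = tt

iterated-slide : ∀ {T α β oα oβ} → 1 ≤ α → 1 ≤ β → Walk T α 1 oα → Walk T β 1 oβ →
                 2 + α ≤ β ⊎ 2 + β ≤ α → IterSlide α β T (grow₂ T oβ oα)
iterated-slide {oβ = nothing} _ 1≤β _ wβ _ = term-inner (walk⇒slide 1≤β wβ)
iterated-slide {T} {oβ = just c} 1≤α 1≤β wα wβ apart =
  step (walk⇒slide 1≤β wβ)
       (walk⇒slide 1≤α (Growth.walk-grow-apart T c (start≤target wβ) wβ wα apart))

lemma3p4 : (T : TowerDiagram) (α β : ℕ) → 1 ≤ α → 1 ≤ β →
           (α + 2 ≤ β ⊎ β + 2 ≤ α) →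
           ∃ λ (o₁ : Maybe TowerDiagram) → ∃ λ (o₂ : Maybe TowerDiagram) →
             IterSlide α β T o₁ × IterSlide β α T o₂ × SameOutcome o₁ o₂
lemma3p4 T α β 1≤α 1≤β apart with walk T 1≤α | walk T 1≤β
... | oα , wα | oβ , wβ =
  grow₂ T oβ oα , grow₂ T oα oβ ,
  iterated-slide 1≤α 1≤β wα wβ apart′ , iterated-slide 1≤β 1≤α wβ wα (swap apart′) ,
  grow₂-comm T oβ oα
  where
  apart′ : 2 + α ≤ β ⊎ 2 + β ≤ α
  apart′ = Data.Sum.map (subst (_≤ β) (+-comm α 2)) (subst (_≤ α) (+-comm β 2)) apart
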